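{- Let $M=[S;A_M;P_M;B_M]$ be a mathematical system with $B_M=B_S$. Then $M$ is not contradictory, i.e. there is no proof in $M$ which contains a formula $F$ as well as its negation $\neg F$.
   Context: Formulas are in Polish notation. Symbols (pairwise disjoint): a set $A_M$ of constant/operation symbols, a set $P_M$ of predicate symbols, a countably infinite set $X$ of variables, and $\sim,(,),\,,\,,\to,\neg,\leftrightarrow,\&,\vee,\forall,\exists$. Lists: $a\in A_M$, $x\in X$, $f(\lambda)$ ($f\in A_M$), concatenations. Prime formulas $\sim\lambda,\mu$ and $p\,\lambda_1,\dots,\lambda_n$ ($n\ge0$, $p\in P_M$); formulas built with $\neg$, $J\in\{\to,\leftrightarrow,\&,\vee\}$, $\forall x$, $\exists x$. $\mathrm{SbF}(F;\mu;x)=F\frac{\mu}{x}$ replaces free occurrences of $x$ by $\mu$; $\mathrm{CF}(F;\mu;x)$: true for prime $F$, passes through connectives, $\mathrm{CF}(QyF;\mu;x)$ iff $x\notin\mathrm{free}(F)\setminus\{y\}$ or ($y\notin\mathrm{var}(\mu)$ and $\mathrm{CF}(F;\mu;x)$). A recursive system $S=[A_S;P_S;B_S]$: finite $A_S\subseteq A_M$, $P_S\subseteq P_M$, and a finite list $B_S$ of R-formulas, i.e. formulas $\to F_1\to F_2\dots\to F_r\,G$ ($r\ge0$) with prime formulas $F_j,G$ over $A_S,P_S$ ($G$ is the R-conclusion). A mathematical system $M=[S;A_M;P_M;B_M]$ has a set $B_M\supseteq B_S$ of basis axioms. Axioms of $M$: all $\alpha(F_1,\dots,F_j)$ with $\alpha$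 an identically true propositional function (connectives $\neg,\to,\leftrightarrow,\&,\vee$, classical truth tables); equality axioms $\sim x,x$, $\to\mathrm{SbF}(\sim\lambda,\mu;x;y)\to\sim x,y\ \sim\lambda,\mu$ (lists $\lambda,\mu$, $x,y\in X$), $\to\sim x_1,y_1\dots\to\sim x_n,y_n\to p\,x_1,..,x_n\ p\,y_1,..,y_n$ ($p\in P_M$, $n\ge1$); quantifier axioms $\to\forall xF\,F$, $\to\forall x\to FG\to F\forall xG$ ($x\notin\mathrm{free}(F)$), $\leftrightarrow\neg\forall x\neg F\ \exists xF$; and $B_M$. Proofs are lists of formulas built from the empty list by: (a) appending an axiom; (b) modus ponens; (c) appending $\mathrm{SbF}(F;\lambda;x)$ for a step $F$ and any list $\lambda$ with $\mathrm{CF}(F;\lambda;x)$; (d) appending $\forall xF$ for a step $F$; (e) Induction: for $p\in P_S$, $i\ge0$, distinct $x_1,\dots,x_i$ and a formula $G$ such that the $x_j$ and the variables of $G$ do not occur in $B_S$: if for every $F\in B_S$ whose R-conclusion is $i$-ary with predicate $p$ the formula obtained from $F$ by replacing each $i$-ary prime subformula $p\,\lambda_1,\dots,\lambda_i$ by $G\frac{\lambda_1}{x_1}\cdots\frac{\lambda_i}{x_i}$ is a step, append $\to p\,x_1,\dots,x_i\,G$. -}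

module Defs where

open import Data.Nat using (ℕ; _≟_)
open import Data.List using (List; []; _∷_; length; map; zip)
open import Data.List.Membership.Propositional using (_∈_)
open import Data.List.Relation.Unary.All using (All)
open import Data.List.Relation.Unary.Any using (Any)
open import Data.List.Relation.Unary.Unique.Propositional using (Unique)
open import Data.List.Relation.Binary.Pointwise using (Pointwise)
open import Data.Fin using (Fin)
open import Data.Bool using (Bool; true; false; not; _∧_; _∨_)
open import Data.Product using (Σ; _×_; _,_; ∃)
open import Data.Sum using (_⊎_)
open import Data.Unit using (⊤)
open import Relation.Nullary using (¬_; yes; no)
open import Relation.Binary.PropositionalEquality using (_≡_; _≢_)

-- A = A_M (constant/operation symbols), P = P_M (predicate
-- symbols), variables X = ℕ.  Formulas are represented by their parse
-- trees (the Polish-notation strings are uniquely readable).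

mutual
  data Item (A : Set) : Set where
    con : A → Item A
    var : ℕ → Item A
    app : A → Lst A → Item A

  data Lst (A : Set) : Set where
    [_] : Item A → Lst A
    _∷_ : Item A → Lst A → Lst A

infixr 5 _++L_
_++L_ : {A : Set} → Lst A → Lst A → Lst A
[ t ] ++L m = t ∷ m
(t ∷ l) ++L m = t ∷ (l ++L m)

data Prime (A P : Set) : Set where
  eqv : Lst A → Lst A → Prime A P
  pr  : P → List (Lst A) → Prime A P

data Conn : Set where
  imp iff and or : Conn

data Quant : Set where
  all ex : Quant

data Formula (A P : Set) : Set where
  prime : Prime A P → Formula A P
  neg   : Formula A P → Formula A P
  bin   : Conn → Formula A P → Formula A P → Formula A P
  qu    : Quant → ℕ → Formula A P → Formula A P

module _ {A P : Set} where

  infixr 4 _⇒_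
  _⇒_ : Formula A P → Formula A P → Formula A P
  F ⇒ G = bin imp F G

  chain : List (Formula A P) → Formula A P → Formula A P
  chain [] G = G
  chain (F ∷ Fs) G = F ⇒ chain Fs G

  mutual
    sbI : Lst A → ℕ → Item A → Lst A
    sbI μ x (con a) = [ con a ]
    sbI μ x (var y) with y ≟ x
    ... | yes _ = μ
    ... | no  _ = [ var y ]
    sbI μ x (app f l) = [ app f (sbL μ x l) ]

    sbL : Lst A → ℕ → Lst A → Lst A
    sbL μ x [ t ] = sbI μ x t
    sbL μ x (t ∷ l) = sbI μ x t ++L sbL μ x l

  sbP : Lst A → ℕ → Prime A P → Prime A P
  sbP μ x (eqv l m) = eqv (sbL μ x l) (sbL μ x m)
  sbP μ x (pr p ls) = pr p (map (sbL μ x) ls)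

  SbF : Formula A P → Lst A → ℕ → Formula A P
  SbF (prime Q) μ x = prime (sbP μ x Q)
  SbF (neg F) μ x = neg (SbF F μ x)
  SbF (bin J F G) μ x = bin J (SbF F μ x) (SbF G μ x)
  SbF (qu q y F) μ x with y ≟ x
  ... | yes _ = qu q y F
  ... | no  _ = qu q y (SbF F μ x)

  mutual
    data OccI (x : ℕ) : Item A → Set where
      here  : OccI x (var x)
      inApp : ∀ {f l} → OccL x l → OccI x (app f l)

    data OccL (x : ℕ) : Lst A → Set where
      one : ∀ {t} → OccI x t → OccL x [ t ]
      hd  : ∀ {t l} → OccI x t → OccL x (t ∷ l)
      tl  : ∀ {t l} → OccL x l → OccL x (t ∷ l)

  data OccP (x : ℕ) : Prime A P → Set where
    eqˡ : ∀ {l m} → OccL x l → OccP x (eqv l m)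
    eqʳ : ∀ {l m} → OccL x m → OccP x (eqv l m)
    arg : ∀ {p ls} → Any (OccL x) ls → OccP x (pr p ls)

  data Free (x : ℕ) : Formula A P → Set where
    fprime : ∀ {Q} → OccP x Q → Free x (prime Q)
    fneg   : ∀ {F} → Free x F → Free x (neg F)
    fbinˡ  : ∀ {J F G} → Free x F → Free x (bin J F G)
    fbinʳ  : ∀ {J F G} → Free x G → Free x (bin J F G)
    fqu    : ∀ {q y F} → x ≢ y → Free x F → Free x (qu q y F)

  data VarOf (x : ℕ) : Formula A P → Set where
    vprime : ∀ {Q} → OccP x Q → VarOf x (prime Q)
    vneg   : ∀ {F} → VarOf x F → VarOf x (neg F)
    vbinˡ  : ∀ {J F G} → VarOf x F → VarOf x (bin J F G)
    vbinʳ  : ∀ {J F G} → VarOf x G → VarOf x (bin J F G)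
    vbound : ∀ {q F} → VarOf x (qu q x F)
    vbody  : ∀ {q y F} → VarOf x F → VarOf x (qu q y F)

  CF : Formula A P → Lst A → ℕ → Set
  CF (prime _) μ x = ⊤
  CF (neg F) μ x = CF F μ x
  CF (bin J F G) μ x = CF F μ x × CF G μ x
  CF (qu q y F) μ x = (x ≡ y ⊎ ¬ Free x F) ⊎ (¬ OccL y μ × CF F μ x)

  data PF (n : ℕ) : Set where
    atom : Fin n → PF n
    pneg : PF n → PF n
    pbin : Conn → PF n → PF n → PF n

  evalC : Conn → Bool → Bool → Bool
  evalC imp a b = not a ∨ b
  evalC iff true b = b
  evalC iff false b = not b
  evalC and a b = a ∧ b
  evalC or a b = a ∨ b

  eval : ∀ {n} → (Fin n → Bool) → PF n → Bool
  eval v (atom i) = v i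
  eval v (pneg α) = not (eval v α)
  eval v (pbin J α β) = evalC J (eval v α) (eval v β)

  inst : ∀ {n} → (Fin n → Formula A P) → PF n → Formula A P
  inst Fs (atom i) = Fs i
  inst Fs (pneg α) = neg (inst Fs α)
  inst Fs (pbin J α β) = bin J (inst Fs α) (inst Fs β)

  IdTrue : ∀ {n} → PF n → Set
  IdTrue α = ∀ v → eval v α ≡ true

  vl : ℕ → Lst A
  vl x = [ var x ]

  data Axiom (basis : List (Formula A P)) : Formula A P → Set where
    taut   : ∀ {n} (α : PF n) (Fs : Fin n → Formula A P) → IdTrue α →
             Axiom basis (inst Fs α)
    eqRefl : ∀ x → Axiom basis (prime (eqv (vl x) (vl x)))
    eqSub  : ∀ (l m : Lst A) (x y : ℕ) →
             Axiom basis (prime (sbP (vl x) y (eqv l m))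
                            ⇒ (prime (eqv (vl x) (vl y)) ⇒ prime (eqv l m)))
    eqPred : ∀ (p : P) (z : ℕ × ℕ) (zs : List (ℕ × ℕ)) →
             let ps = z ∷ zs in
             Axiom basis (chain (map (λ { (x , y) → prime (eqv (vl x) (vl y)) }) ps)
                            (prime (pr p (map (λ { (x , y) → vl x }) ps))
                              ⇒ prime (pr p (map (λ { (x , y) → vl y }) ps))))
    qInst  : ∀ x F → Axiom basis (qu all x F ⇒ F)
    qDist  : ∀ x F G → ¬ Free x F →
             Axiom basis (qu all x (F ⇒ G) ⇒ (F ⇒ qu all x G))
    qEx    : ∀ x F → Axiom basis (bin iff (neg (qu all x (neg F))) (qu ex x F))
    bas    : ∀ {F} → F ∈ basis → Axiom basis F

mutual
  data OkI {A : Set} (AS : List A) : Item A → Set where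
    con : ∀ {a} → a ∈ AS → OkI AS (con a)
    var : ∀ {x} → OkI AS (var x)
    app : ∀ {f l} → f ∈ AS → OkL AS l → OkI AS (app f l)

  data OkL {A : Set} (AS : List A) : Lst A → Set where
    one : ∀ {t} → OkI AS t → OkL AS [ t ]
    cns : ∀ {t l} → OkI AS t → OkL AS l → OkL AS (t ∷ l)

OverP : {A P : Set} → List A → (P → Set) → Prime A P → Set
OverP AS PS (eqv l m) = OkL AS l × OkL AS m
OverP AS PS (pr p ls) = PS p × All (OkL AS) ls

record RForm (A P : Set) (AS : List A) (PS : P → Set) : Set where
  constructor rform
  field
    prems   : List (Prime A P)
    concl   : Prime A P
    premsOk : All (OverP AS PS) prems
    conclOk : OverP AS PS concl

rToF : ∀ {A P AS PS} → RForm A P AS PS → Formula A P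
rToF r = chain (map prime (RForm.prems r)) (prime (RForm.concl r))

module _ {A P : Set} where

  substMany : Formula A P → List (ℕ × Lst A) → Formula A P
  substMany G [] = G
  substMany G ((x , l) ∷ r) = substMany (SbF G l x) r

  data ReplP (p : P) (xs : List ℕ) (G : Formula A P) : Prime A P → Formula A P → Set where
    hit    : ∀ (ls : List (Lst A)) → length ls ≡ length xs →
             ReplP p xs G (pr p ls) (substMany G (zip xs ls))
    missEq : ∀ l m → ReplP p xs G (eqv l m) (prime (eqv l m))
    missPr : ∀ q ls → ¬ (q ≡ p × length ls ≡ length xs) →
             ReplP p xs G (pr q ls) (prime (pr q ls))

  ReplR : ∀ {AS PS} → P → List ℕ → Formula A P → RForm A P AS PS → Formula A P → Set
  ReplR p xs G r F′ =
    Σ (List (Formula A P)) λ Fs → Σ (Formula A P) λ C →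
      Pointwise (ReplP p xs G) (RForm.prems r) Fs × ReplP p xs G (RForm.concl r) C
      × F′ ≡ chain Fs C

  -- Proofs in M = [S; A_M; P_M; B_M] with S = [A_S; P_S; B_S] and B_M = B_S.
  -- A proof is a list of formulas; the most recently appended step is
  -- the head of the list.
  module _ (AS : List A) (PS : P → Set) (BS : List (RForm A P AS PS)) where

    basisM : List (Formula A P)
    basisM = map rToF BS

    OccBS : ℕ → Set
    OccBS x = Any (λ r → VarOf x (rToF r)) BS

    data Proof : List (Formula A P) → Set where
      empty : Proof []
      ax    : ∀ {Π F} → Proof Π → Axiom basisM F → Proof (F ∷ Π)
      mp    : ∀ {Π F G} → Proof Π → F ∈ Π → (F ⇒ G) ∈ Π → Proof (G ∷ Π)
      sb    : ∀ {Π F} → Proof Π → F ∈ Π → (μ : Lst A) (x : ℕ) → CF F μ x →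
              Proof (SbF F μ x ∷ Π)
      gen   : ∀ {Π F} → Proof Π → F ∈ Π → (x : ℕ) → Proof (qu all x F ∷ Π)
      ind   : ∀ {Π} → Proof Π →
              (p : P) → PS p → (xs : List ℕ) → Unique xs → (G : Formula A P) →
              All (λ x → ¬ OccBS x) xs →
              (∀ y → VarOf y G → ¬ OccBS y) →
              (∀ r → r ∈ BS →
                 (Σ (List (Lst A)) λ ls →
                    RForm.concl r ≡ pr p ls × length ls ≡ length xs) →
                 Σ (Formula A P) λ F′ → ReplR {AS} {PS} p xs G r F′ × F′ ∈ Π) →
              Proof ((prime (pr p (map (vl {A} {P}) xs)) ⇒ G) ∷ Π)

    Contradictory : Set
    Contradictory = Σ (List (Formula A P)) λ Π → Σ (Formula A P) λ F →
                      Proof Π × F ∈ Π × neg F ∈ Π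

{-# OPTIONS --safe #-}
module Submission where

-- Interpret a formula as an Agda proposition that forgets all terms and
-- quantifiers: equations are true, and p λ₁,…,λₙ means "not not (p is
-- derivable with arity n from the R-formulas of B_S)".  Every interpretation
-- is ¬¬-stable, so the classical tautologies are valid; substitution does not
-- change the interpretation; the R-formulas hold by construction of
-- derivability, and the induction rule holds because derivability is the
-- least relation closed under them.  Hence every step of a proof is valid, and
-- no formula is valid together with its negation.

open import Defs
open import Data.Bool using (Bool)
open import Data.Empty using (⊥-elim)
open import Data.Fin using (Fin; zero; suc)
open import Data.List using (List; []; _∷_; length; map; zip)
open import Data.List.Membership.Propositional using (_∈_)
open import Data.List.Membership.Propositional.Properties using (∈-map⁻)
open import Data.List.Properties using (length-map)
open import Data.List.Relation.Unary.All using (All; []; _∷_; lookup)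
open import Data.List.Relation.Binary.Pointwise using (Pointwise; []; _∷_)
open import Data.Nat using (ℕ; _≟_)
open import Data.Product using (Σ-syntax; _×_; _,_; proj₁; proj₂)
open import Data.Unit using (⊤; tt)
open import Function using (id; _∘_)
open import Relation.Binary.PropositionalEquality using (_≡_; refl; sym; trans; cong; cong₂; subst)
open import Relation.Nullary using (¬_; yes; no; Dec; does; proof; ¬¬-excluded-middle)
open import Relation.Nullary.Negation using (Stable; ¬¬-map)
open import Relation.Nullary.Reflects using (Reflects; ofʸ; ofⁿ; invert; ¬-reflects; _×-reflects_; _→-reflects_)

¬¬-decidable-Fin : ∀ n (S : Fin n → Set) → ¬ ¬ (∀ i → Dec (S i))
¬¬-decidable-Fin ℕ.zero S k = k λ ()
¬¬-decidable-Fin (ℕ.suc n) S k =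
  ¬¬-excluded-middle λ S₀? → ¬¬-decidable-Fin n (S ∘ suc) λ S? →
    k λ { zero → S₀? ; (suc i) → S? i }

-- Disjunction is read negatively so that every interpretation is ¬¬-stable.
⟦_⟧ᶜ : Conn → Set → Set → Set
⟦ imp ⟧ᶜ X Y = X → Y
⟦ iff ⟧ᶜ X Y = (X → Y) × (Y → X)
⟦ and ⟧ᶜ X Y = X × Y
⟦ or  ⟧ᶜ X Y = ¬ (¬ X × ¬ Y)

module Semantics {A P : Set} (AS : List A) (PS : P → Set) (BS : List (RForm A P AS PS)) where

  ⟦⟧ᶜ-reflects : ∀ J {X Y a b} → Reflects X a → Reflects Y b →
                 Reflects (⟦ J ⟧ᶜ X Y) (evalC {A} {P} J a b)
  ⟦⟧ᶜ-reflects imp x y = x →-reflects y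
  ⟦⟧ᶜ-reflects and x y = x ×-reflects y
  ⟦⟧ᶜ-reflects iff (ofʸ x)  (ofʸ y)  = ofʸ ((λ _ → y) , (λ _ → x))
  ⟦⟧ᶜ-reflects iff (ofʸ x)  (ofⁿ ¬y) = ofⁿ (λ x⇔y → ¬y (proj₁ x⇔y x))
  ⟦⟧ᶜ-reflects iff (ofⁿ ¬x) (ofʸ y)  = ofⁿ (λ x⇔y → ¬x (proj₂ x⇔y y))
  ⟦⟧ᶜ-reflects iff (ofⁿ ¬x) (ofⁿ ¬y) = ofʸ ((λ x → ⊥-elim (¬x x)) , (λ y → ⊥-elim (¬y y)))
  ⟦⟧ᶜ-reflects or  (ofʸ x)  _        = ofʸ (λ ¬x×¬y → proj₁ ¬x×¬y x)
  ⟦⟧ᶜ-reflects or  (ofⁿ ¬x) (ofʸ y)  = ofʸ (λ ¬x×¬y → proj₂ ¬x×¬y y)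
  ⟦⟧ᶜ-reflects or  (ofⁿ ¬x) (ofⁿ ¬y) = ofⁿ (λ k → k (¬x , ¬y))

  mutual
    data Derivable : P → ℕ → Set where
      derive : ∀ {r q ls} → r ∈ BS → RForm.concl r ≡ pr q ls →
               All Holds (RForm.prems r) → Derivable q (length ls)

    Holds : Prime A P → Set
    Holds (eqv _ _) = ⊤
    Holds (pr q ls) = Derivable q (length ls)

  ⟦_⟧ᵖ : Prime A P → Set
  ⟦ eqv _ _ ⟧ᵖ = ⊤
  ⟦ pr q ls ⟧ᵖ = ¬ ¬ Derivable q (length ls)

  ⟦_⟧ : Formula A P → Set
  ⟦ prime Q ⟧ = ⟦ Q ⟧ᵖ
  ⟦ neg F ⟧ = ¬ ⟦ F ⟧
  ⟦ bin J F G ⟧ = ⟦ J ⟧ᶜ ⟦ F ⟧ ⟦ G ⟧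
  ⟦ qu _ _ F ⟧ = ⟦ F ⟧

  ⟦⟧-stable : ∀ F → Stable ⟦ F ⟧
  ⟦⟧-stable (prime (eqv _ _)) _ = tt
  ⟦⟧-stable (prime (pr q ls)) k ¬d = k (λ ¬¬d → ¬¬d ¬d)
  ⟦⟧-stable (neg F) k f = k (λ ¬f → ¬f f)
  ⟦⟧-stable (bin imp F G) k f = ⟦⟧-stable G (λ ¬g → k (λ f⇒g → ¬g (f⇒g f)))
  ⟦⟧-stable (bin iff F G) k =
    (λ f → ⟦⟧-stable G (λ ¬g → k (λ f⇔g → ¬g (proj₁ f⇔g f)))) ,
    (λ g → ⟦⟧-stable F (λ ¬f → k (λ f⇔g → ¬f (proj₂ f⇔g g))))
  ⟦⟧-stable (bin and F G) k =
    ⟦⟧-stable F (λ ¬f → k (¬f ∘ proj₁)) , ⟦⟧-stable G (λ ¬g → k (¬g ∘ proj₂))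
  ⟦⟧-stable (bin or F G) k ¬f×¬g = k (λ f∨g → f∨g ¬f×¬g)
  ⟦⟧-stable (qu _ _ F) k = ⟦⟧-stable F k

  ⟦SbF⟧≡⟦⟧ : ∀ F μ x → ⟦ SbF F μ x ⟧ ≡ ⟦ F ⟧
  ⟦SbF⟧≡⟦⟧ (prime (eqv _ _)) μ x = refl
  ⟦SbF⟧≡⟦⟧ (prime (pr q ls)) μ x =
    cong (λ n → ¬ ¬ Derivable q n) (length-map (sbL {A} {P} μ x) ls)
  ⟦SbF⟧≡⟦⟧ (neg F) μ x = cong ¬_ (⟦SbF⟧≡⟦⟧ F μ x)
  ⟦SbF⟧≡⟦⟧ (bin J F G) μ x = cong₂ ⟦ J ⟧ᶜ (⟦SbF⟧≡⟦⟧ F μ x) (⟦SbF⟧≡⟦⟧ G μ x)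
  ⟦SbF⟧≡⟦⟧ (qu q y F) μ x with y ≟ x
  ... | yes _ = refl
  ... | no _ = ⟦SbF⟧≡⟦⟧ F μ x

  ⟦substMany⟧≡⟦⟧ : ∀ G s → ⟦ substMany G s ⟧ ≡ ⟦ G ⟧
  ⟦substMany⟧≡⟦⟧ G [] = refl
  ⟦substMany⟧≡⟦⟧ G ((x , μ) ∷ s) = trans (⟦substMany⟧≡⟦⟧ (SbF G μ x) s) (⟦SbF⟧≡⟦⟧ G μ x)

  ⟦inst⟧-reflects : ∀ {n} (v : Fin n → Bool) (Fs : Fin n → Formula A P) →
                    (∀ i → Reflects ⟦ Fs i ⟧ (v i)) → ∀ α → Reflects ⟦ inst Fs α ⟧ (eval v α)
  ⟦inst⟧-reflects v Fs r (atom i) = r i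
  ⟦inst⟧-reflects v Fs r (pneg α) = ¬-reflects (⟦inst⟧-reflects v Fs r α)
  ⟦inst⟧-reflects v Fs r (pbin J α β) =
    ⟦⟧ᶜ-reflects J (⟦inst⟧-reflects v Fs r α) (⟦inst⟧-reflects v Fs r β)

  ⟦inst⟧-tautology : ∀ {n} (α : PF n) (Fs : Fin n → Formula A P) → IdTrue α → ⟦ inst Fs α ⟧
  ⟦inst⟧-tautology {n} α Fs α-true =
    ⟦⟧-stable (inst Fs α) (¬¬-map valid-if-decided (¬¬-decidable-Fin n (⟦_⟧ ∘ Fs)))
    where
    valid-if-decided : (∀ i → Dec ⟦ Fs i ⟧) → ⟦ inst Fs α ⟧
    valid-if-decided Fs? =
      invert (subst (Reflects ⟦ inst Fs α ⟧) (α-true v) (⟦inst⟧-reflects v Fs (proof ∘ Fs?) α))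
      where
      v : Fin n → Bool
      v = does ∘ Fs?

  ⟦chain⟧-conclusion : ∀ Fs {C} → ⟦ C ⟧ → ⟦ chain Fs C ⟧
  ⟦chain⟧-conclusion [] c = c
  ⟦chain⟧-conclusion (F ∷ Fs) c = λ _ → ⟦chain⟧-conclusion Fs c

  ⟦chain⟧-elim : ∀ Fs {C} → ⟦ chain Fs C ⟧ → All ⟦_⟧ Fs → ⟦ C ⟧
  ⟦chain⟧-elim [] c [] = c
  ⟦chain⟧-elim (F ∷ Fs) f⇒c (f ∷ fs) = ⟦chain⟧-elim Fs (f⇒c f) fs

  ⟦chain⟧-intro : ∀ L C → (All Holds L → ⟦ C ⟧ᵖ) → ⟦ chain (map prime L) (prime C) ⟧
  ⟦chain⟧-intro [] C k = k []
  ⟦chain⟧-intro (eqv l m ∷ L) C k = λ _ → ⟦chain⟧-intro L C (k ∘ (tt ∷_))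
  ⟦chain⟧-intro (pr q ls ∷ L) C k = λ ¬¬d →
    ⟦⟧-stable (chain (map prime L) (prime C))
      (¬¬-map (λ d → ⟦chain⟧-intro L C (k ∘ (d ∷_))) ¬¬d)

  ⟦basis⟧ : ∀ {F} → F ∈ basisM AS PS BS → ⟦ F ⟧
  ⟦basis⟧ F∈ with ∈-map⁻ rToF F∈
  ... | r , r∈ , refl = ⟦chain⟧-intro (RForm.prems r) (RForm.concl r) (conclusion-holds refl)
    where
    conclusion-holds : ∀ {C} → RForm.concl r ≡ C → All Holds (RForm.prems r) → ⟦ C ⟧ᵖ
    conclusion-holds {eqv _ _} _ _ = tt
    conclusion-holds {pr q ls} r⊢C premises ¬d = ¬d (derive r∈ r⊢C premises)

  ⟦axiom⟧ : ∀ {F} → Axiom (basisM AS PS BS) F → ⟦ F ⟧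
  ⟦axiom⟧ (taut α Fs α-true) = ⟦inst⟧-tautology α Fs α-true
  ⟦axiom⟧ (eqRefl x) = tt
  ⟦axiom⟧ (eqSub l m x y) = λ _ _ → tt
  ⟦axiom⟧ (eqPred p z zs) =
    ⟦chain⟧-conclusion (map _ (z ∷ zs))
      (subst (λ n → ¬ ¬ Derivable p n)
             (trans (length-map _ (z ∷ zs)) (sym (length-map _ (z ∷ zs)))))
  ⟦axiom⟧ (qInst x F) = id
  ⟦axiom⟧ (qDist x F G _) = id
  ⟦axiom⟧ (qEx x F) = ⟦⟧-stable F , (λ f ¬f → ¬f f)
  ⟦axiom⟧ (bas F∈) = ⟦basis⟧ F∈

  InductionStepsValid : P → List ℕ → Formula A P → Set
  InductionStepsValid p xs G =
    ∀ r → r ∈ BS → (Σ[ ls ∈ List (Lst A) ] RForm.concl r ≡ pr p ls × length ls ≡ length xs) →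
    Σ[ F′ ∈ Formula A P ] ReplR {AS = AS} {PS} p xs G r F′ × ⟦ F′ ⟧

  module _ {p : P} {xs : List ℕ} {G : Formula A P} (steps : InductionStepsValid p xs G) where

    replaced-conclusion : ∀ {Q C ls} → Q ≡ pr p ls → length ls ≡ length xs →
                          ReplP p xs G Q C → ⟦ C ⟧ → ⟦ G ⟧
    replaced-conclusion refl _ (hit ls _) = subst id (⟦substMany⟧≡⟦⟧ G (zip xs ls))
    replaced-conclusion refl ∣ls∣≡∣xs∣ (missPr _ _ ¬hit) = ⊥-elim (¬hit (refl , ∣ls∣≡∣xs∣))

    mutual
      Derivable⇒⟦G⟧ : ∀ {q n} → Derivable q n → q ≡ p → n ≡ length xs → ⟦ G ⟧
      Derivable⇒⟦G⟧ (derive {r} {ls = ls} r∈ r⊢C premises) refl ∣ls∣≡∣xs∣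
        with steps r r∈ (ls , r⊢C , ∣ls∣≡∣xs∣)
      ... | _ , (Fs , C , premises↦Fs , C↦ , refl) , ⟦F′⟧ =
        replaced-conclusion r⊢C ∣ls∣≡∣xs∣ C↦
          (⟦chain⟧-elim Fs ⟦F′⟧ (replaced-premises premises premises↦Fs))

      replaced-premises : ∀ {L Fs} → All Holds L → Pointwise (ReplP p xs G) L Fs → All ⟦_⟧ Fs
      replaced-premises [] [] = []
      replaced-premises (d ∷ hs) (hit ls ∣ls∣≡∣xs∣ ∷ L↦Fs) =
        subst id (sym (⟦substMany⟧≡⟦⟧ G (zip xs ls))) (Derivable⇒⟦G⟧ d refl ∣ls∣≡∣xs∣)
          ∷ replaced-premises hs L↦Fs
      replaced-premises (_ ∷ hs) (missEq _ _ ∷ L↦Fs) = tt ∷ replaced-premises hs L↦Fs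
      replaced-premises (d ∷ hs) (missPr _ _ _ ∷ L↦Fs) = (λ ¬d → ¬d d) ∷ replaced-premises hs L↦Fs

    ⟦induction⟧ : ⟦ prime (pr p (map (vl {A} {P}) xs)) ⇒ G ⟧
    ⟦induction⟧ ¬¬d =
      ⟦⟧-stable G (¬¬-map (λ d → Derivable⇒⟦G⟧ d refl (length-map (vl {A} {P}) xs)) ¬¬d)

  ⟦proof⟧ : ∀ {Π} → Proof AS PS BS Π → All ⟦_⟧ Π
  ⟦proof⟧ empty = []
  ⟦proof⟧ (ax π a) = ⟦axiom⟧ a ∷ ⟦proof⟧ π
  ⟦proof⟧ (mp π F∈ F⇒G∈) = let ⟦π⟧ = ⟦proof⟧ π in lookup ⟦π⟧ F⇒G∈ (lookup ⟦π⟧ F∈) ∷ ⟦π⟧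
  ⟦proof⟧ (sb {F = F} π F∈ μ x _) =
    let ⟦π⟧ = ⟦proof⟧ π in subst id (sym (⟦SbF⟧≡⟦⟧ F μ x)) (lookup ⟦π⟧ F∈) ∷ ⟦π⟧
  ⟦proof⟧ (gen π F∈ x) = let ⟦π⟧ = ⟦proof⟧ π in lookup ⟦π⟧ F∈ ∷ ⟦π⟧
  ⟦proof⟧ (ind {Π} π p _ xs _ G _ _ steps) =
    ⟦induction⟧ steps-valid ∷ ⟦π⟧
    where
    ⟦π⟧ : All ⟦_⟧ Π
    ⟦π⟧ = ⟦proof⟧ π
    steps-valid : InductionStepsValid p xs G
    steps-valid r r∈ concl-p =
      let (F′ , r↦F′ , F′∈) = steps r r∈ concl-p in F′ , r↦F′ , lookup ⟦π⟧ F′∈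

mainTheorem18 : {A P : Set} (AS : List A) (PS : P → Set) (BS : List (RForm A P AS PS)) →
    ¬ Contradictory AS PS BS
mainTheorem18 AS PS BS (Π , F , π , F∈ , ¬F∈) =
  lookup ⟦π⟧ ¬F∈ (lookup ⟦π⟧ F∈)
  where
  open Semantics AS PS BS
  ⟦π⟧ : All ⟦_⟧ Π
  ⟦π⟧ = ⟦proof⟧ π
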